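{- For every word $u$ over $\mathbf{V}'$ of length $n$ and every term $t$, the following are equivalent: (1) $\mathsf{LANG} \models u \le t$; (2) $\hat{\mathfrak{v}}(u) \subseteq \hat{\mathfrak{v}}(t)$ for all language valuations $\mathfrak{v}$ over $\{\ell_0, \dots, \ell_{n-1}\}$ such that $\mathfrak{v}(x) \subseteq \{\ell_i \cdots \ell_{j-1} \mid 0 \le i \le j \le n\}$ for all variables $x$; (3) $\hat{\mathfrak{v}}^{\langle w_0, \dots, w_{n-1}\rangle}(u) \subseteq \hat{\mathfrak{v}}^{\langle w_0, \dots, w_{n-1}\rangle}(t)$ for all language valuations $\mathfrak{v}$ (over any set $X$) and all words $w_0, \dots, w_{n-1}$ over $X$.
   Context: Let $\mathbf{V}$ be a set of variables and $\mathbf{V}' = \{x, x^{ - } \mid x \in \mathbf{V}\}$. Terms are generated by $t, s ::= x \mid \mathrm{I} \mid \bot \mid t \cdot s \mid t \cup s \mid t^{*} \mid x^{ - }$ ($x \in \mathbf{V}$); a word $y_0\cdots y_{m-1}$ over $\mathbf{V}'$ is viewed as the term $y_0\cdot\ldots\cdot y_{m-1}$ (empty word as $\mathrm{I}$). For a set $X$, a language valuation over $X$ is a map $\mathfrak{v}$ from variables to subsets of $X^{*}$ ($\mathrm{I}$ = empty word), extended to terms $\hat{\mathfrak{v}}$ by $\hat{\mathfrak{v}}(\mathrm{I}) = \{\mathrm{I}\}$, $\hat{\mathfrak{v}}(\bot) = \emptyset$, $\hat{\mathfrak{v}}(t\cdot s) = \{ab \mid a \in \hat{\mathfrak{v}}(t),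 b \in \hat{\mathfrak{v}}(s)\}$, $\hat{\mathfrak{v}}(t \cup s) = \hat{\mathfrak{v}}(t)\cup\hat{\mathfrak{v}}(s)$, $\hat{\mathfrak{v}}(t^{*}) = \hat{\mathfrak{v}}(t)^{*}$, $\hat{\mathfrak{v}}(x^{ - }) = X^{*} \setminus \mathfrak{v}(x)$. $\mathsf{LANG} \models t \le s$ means $\hat{\mathfrak{v}}(t) \subseteq \hat{\mathfrak{v}}(s)$ for all language valuations over all sets. For a language valuation $\mathfrak{v}$ over $X$ and words $w_0, \dots, w_{n-1}$ over $X$, with $\ell_0, \dots, \ell_{n-1}$ pairwise distinct letters, $\mathfrak{v}^{\langle w_0, \dots, w_{n-1}\rangle}$ is the language valuation over $\{\ell_0, \dots, \ell_{n-1}\}$ given by $\mathfrak{v}^{\langle w_0, \dots, w_{n-1}\rangle}(x) = \{\ell_i \cdots \ell_{j-1} \mid 0 \le i \le j \le n,\ w_i \cdots w_{j-1} \in \mathfrak{v}(x)\}$. -}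

module Defs where

open import Data.Nat using (ℕ; _≤_; _∸_)
open import Data.Fin using (Fin)
open import Data.List using (List; []; _∷_; _++_; take; drop; concat)
open import Data.List using () renaming (allFin to allFinL)
open import Data.Vec using (Vec; toList)
open import Data.Product using (Σ; ∃; _×_; _,_)
open import Data.Sum using (_⊎_)
open import Data.Empty renaming (⊥ to Empty)
open import Relation.Nullary using (¬_)
open import Relation.Binary.PropositionalEquality using (_≡_)

data Term (V : Set) : Set where
  var  : V → Term V
  I    : Term V
  ⊥t   : Term V
  _·_  : Term V → Term V → Term V
  _∪_  : Term V → Term V → Term V
  _*   : Term V → Term V
  _⁻   : V → Term V

-- Letters of V' = { x , x⁻ | x ∈ V }
data Letter (V : Set) : Set where
  pos : V → Letter V
  neg : V → Letter V

Word : Set → Set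
Word V = List (Letter V)

letterTerm : {V : Set} → Letter V → Term V
letterTerm (pos x) = var x
letterTerm (neg x) = x ⁻

wordTerm : {V : Set} → Word V → Term V
wordTerm []       = I
wordTerm (y ∷ []) = letterTerm y
wordTerm (y ∷ ys@(_ ∷ _)) = letterTerm y · wordTerm ys

Lang : Set → Set₁
Lang X = List X → Set

_⊆_ : {X : Set} → Lang X → Lang X → Set
L ⊆ M = ∀ w → L w → M w

Valuation : Set → Set → Set₁
Valuation V X = V → Lang X

data Star {X : Set} (L : Lang X) : Lang X where
  nil  : Star L []
  cons : ∀ {a b} → L a → Star L b → Star L (a ++ b)

⟦_⟧ : {V X : Set} → Term V → Valuation V X → Lang X
⟦ var x ⟧ v w = v x w
⟦ I ⟧ v w = w ≡ []
⟦ ⊥t ⟧ v w = Empty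
⟦ t · s ⟧ v w = Σ _ λ a → Σ _ λ b → (w ≡ a ++ b) × ⟦ t ⟧ v a × ⟦ s ⟧ v b
⟦ t ∪ s ⟧ v w = ⟦ t ⟧ v w ⊎ ⟦ s ⟧ v w
⟦ t * ⟧ v w = Star (⟦ t ⟧ v) w
⟦ x ⁻ ⟧ v w = ¬ (v x w)

LANG⊨_≤_ : {V : Set} → Term V → Term V → Set₁
LANG⊨ t ≤ s = ∀ (X : Set) (v : Valuation _ X) → ⟦ t ⟧ v ⊆ ⟦ s ⟧ v

-- The letters ℓ₀,…,ℓ_{n-1} are the elements of Fin n.
-- seg n i j = ℓ_i ⋯ ℓ_{j-1}
seg : (n : ℕ) → ℕ → ℕ → List (Fin n)
seg n i j = take (j ∸ i) (drop i (allFinL n))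

wseg : {X : Set} {n : ℕ} → Vec (List X) n → ℕ → ℕ → List X
wseg w i j = concat (take (j ∸ i) (drop i (toList w)))

restrict : {V X : Set} {n : ℕ} → Valuation V X → Vec (List X) n → Valuation V (Fin n)
restrict {n = n} v w x s =
  Σ ℕ λ i → Σ ℕ λ j → i ≤ j × j ≤ n × (s ≡ seg n i j) × v x (wseg w i j)

SegmentValued : {V : Set} (n : ℕ) → Valuation V (Fin n) → Set
SegmentValued n v = ∀ x s → v x s → Σ ℕ λ i → Σ ℕ λ j → i ≤ j × j ≤ n × (s ≡ seg n i j)

{-# OPTIONS --safe #-}
module Submission where

-- Let h : {ℓ₀,…,ℓₙ₋₁}* → X* be the monoid homomorphism ℓᵢ ↦ wᵢ (`expand w`).
-- By construction ℓᵢ⋯ℓⱼ₋₁ ∈ 𝔳^⟨w⟩(x) iff wᵢ⋯wⱼ₋₁ ∈ 𝔳(x); every factor of a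
-- segment is again a segment, so by induction on t, h maps the segments in
-- 𝔳̂^⟨w⟩(t) into 𝔳̂(t), complements included.  Hence (3) ⇒ (1): a word
-- w₀⋯wₙ₋₁ ∈ 𝔳̂(u), factored along the letters of u, puts the full segment
-- ℓ₀⋯ℓₙ₋₁ into 𝔳̂^⟨w⟩(u), hence into 𝔳̂^⟨w⟩(t), and h maps it back into 𝔳̂(t).
-- (2) ⇒ (3) holds because 𝔳^⟨w⟩ is segment-valued, and (1) implies the other
-- two outright.

open import Defs
open import Data.Nat using (ℕ; zero; suc; _+_; _∸_; _≤_; z≤n; s≤s)
open import Data.Nat.Properties
  using (≤-trans; ≤-reflexive; m≤m+n; m≤n+m; n≤1+n; +-monoʳ-≤; +-suc; +-identityʳ;
         m+n∸m≡n; m+n∸n≡m; m+[n∸m]≡n; ∸-monoˡ-≤; ∸-+-assoc; n∸n≡0)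
open import Data.Fin using (Fin)
open import Data.List using (List; []; _∷_; _++_; length; take; drop; concat; map; tabulate; allFin)
open import Data.List.Properties
  using (∷-injective; take-[]; drop-drop; take-map; drop-map; map-++; concat-++;
         map-tabulate; take-all; ++-identityʳ)
open import Data.List.Relation.Binary.Pointwise using (Pointwise; []; _∷_)
open import Data.Vec as Vec using (Vec; toList)
open import Data.Vec.Properties using (length-toList)
open import Data.Product using (Σ; ∃; _×_; _,_)
open import Data.Sum using (inj₁; inj₂)
open import Function.Bundles using (_⇔_; mk⇔; Equivalence)
open import Relation.Binary.PropositionalEquality
open ≡-Reasoning

slice : {A : Set} → ℕ → ℕ → List A → List A
slice i j xs = take (j ∸ i) (drop i xs)

take-++-take : {A : Set} {m n : ℕ} (xs : List A) → m ≤ n →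
  take m xs ++ take (n ∸ m) (drop m xs) ≡ take n xs
take-++-take xs       z≤n       = refl
take-++-take []       (s≤s _)   = take-[] _
take-++-take (x ∷ xs) (s≤s m≤n) = cong (x ∷_) (take-++-take xs m≤n)

take≡++⇒ : {A : Set} (m : ℕ) (xs a b : List A) → take m xs ≡ a ++ b →
  length a ≤ m × a ≡ take (length a) xs × b ≡ take (m ∸ length a) (drop (length a) xs)
take≡++⇒ m       xs       []      b eq = z≤n , refl , sym eq
take≡++⇒ zero    xs       (c ∷ a) b ()
take≡++⇒ (suc m) []       (c ∷ a) b ()
take≡++⇒ (suc m) (x ∷ xs) (c ∷ a) b eq with ∷-injective eq
... | refl , eq′ with take≡++⇒ m xs a b eq′
... | la≤m , a≡ , b≡ = s≤s la≤m , cong (x ∷_) a≡ , b≡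

slice-++ : {A : Set} {i k j : ℕ} (xs : List A) → i ≤ k → k ≤ j →
  slice i k xs ++ slice k j xs ≡ slice i j xs
slice-++ {i = i} {k} {j} xs i≤k k≤j = begin
  take (k ∸ i) ys ++ take (j ∸ k) (drop k xs)
    ≡⟨ cong₂ (λ m d → take (k ∸ i) ys ++ take m (drop d xs)) j∸k≡ (sym i+[k∸i]≡k) ⟩
  take (k ∸ i) ys ++ take ((j ∸ i) ∸ (k ∸ i)) (drop (i + (k ∸ i)) xs)
    ≡⟨ cong (λ zs → take (k ∸ i) ys ++ take ((j ∸ i) ∸ (k ∸ i)) zs) (drop-drop i (k ∸ i) xs) ⟨
  take (k ∸ i) ys ++ take ((j ∸ i) ∸ (k ∸ i)) (drop (k ∸ i) ys)
    ≡⟨ take-++-take ys (∸-monoˡ-≤ i k≤j) ⟩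
  take (j ∸ i) ys ∎
  where
  ys = drop i xs
  i+[k∸i]≡k : i + (k ∸ i) ≡ k
  i+[k∸i]≡k = m+[n∸m]≡n i≤k
  j∸k≡ : j ∸ k ≡ (j ∸ i) ∸ (k ∸ i)
  j∸k≡ = trans (cong (j ∸_) (sym i+[k∸i]≡k)) (sym (∸-+-assoc j i (k ∸ i)))

slice≡++⇒ : {A : Set} {i j : ℕ} (xs a b : List A) → i ≤ j → slice i j xs ≡ a ++ b →
  ∃ λ k → i ≤ k × k ≤ j × a ≡ slice i k xs × b ≡ slice k j xs
slice≡++⇒ {i = i} {j} xs a b i≤j eq with take≡++⇒ (j ∸ i) (drop i xs) a b eq
... | la≤j∸i , a≡ , b≡ =
  i + length a , m≤m+n i (length a) , i+la≤j ,
  trans a≡ (cong (λ m → take m (drop i xs)) (sym (m+n∸m≡n i (length a)))) ,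
  trans b≡ (cong₂ take (∸-+-assoc j i (length a)) (drop-drop i (length a) xs))
  where
  i+la≤j : i + length a ≤ j
  i+la≤j = ≤-trans (+-monoʳ-≤ i la≤j∸i) (≤-reflexive (m+[n∸m]≡n i≤j))

slice-single : {A : Set} (k : ℕ) (xs : List A) {x : A} {rest : List A} →
  drop k xs ≡ x ∷ rest → slice k (suc k) xs ≡ x ∷ []
slice-single k xs eq = cong₂ take (m+n∸n≡m 1 k) eq

drop≡∷⇒drop-suc : {A : Set} (k : ℕ) (xs : List A) {x : A} {rest : List A} →
  drop k xs ≡ x ∷ rest → drop (suc k) xs ≡ rest
drop≡∷⇒drop-suc zero    (x ∷ xs) refl = refl
drop≡∷⇒drop-suc (suc k) (x ∷ xs) eq   = drop≡∷⇒drop-suc k xs eq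

IsSegment : (n : ℕ) → List (Fin n) → Set
IsSegment n s = Σ ℕ λ i → Σ ℕ λ j → i ≤ j × j ≤ n × (s ≡ seg n i j)

IsSegment-++⁻ : (n : ℕ) (a b : List (Fin n)) → IsSegment n (a ++ b) → IsSegment n a × IsSegment n b
IsSegment-++⁻ n a b (i , j , i≤j , j≤n , eq) with slice≡++⇒ (allFin n) a b i≤j (sym eq)
... | k , i≤k , k≤j , a≡ , b≡ = (i , k , i≤k , ≤-trans k≤j j≤n , a≡) , (k , j , k≤j , j≤n , b≡)

map-lookup-allFin : {A : Set} {n : ℕ} (w : Vec A n) → map (Vec.lookup w) (allFin n) ≡ toList w
map-lookup-allFin w = trans (map-tabulate (λ i → i) (Vec.lookup w)) (tabulate-lookup w)
  where
  tabulate-lookup : {m : ℕ} (w : Vec _ m) → tabulate (Vec.lookup w) ≡ toList w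
  tabulate-lookup Vec.[]       = refl
  tabulate-lookup (x Vec.∷ w) = cong (x ∷_) (tabulate-lookup w)

wordTerm-factor : {V X : Set} (v : Valuation V X) (ys : Word V) {a : List X} → ⟦ wordTerm ys ⟧ v a →
  Σ (Vec (List X) (length ys)) λ ws →
    Pointwise (λ y → ⟦ letterTerm y ⟧ v) ys (toList ws) × concat (toList ws) ≡ a
wordTerm-factor v []           refl = Vec.[] , [] , refl
wordTerm-factor v (y ∷ [])     {a} p = a Vec.∷ Vec.[] , p ∷ [] , ++-identityʳ a
wordTerm-factor v (y ∷ y′ ∷ ys) (a , b , refl , p , q) with wordTerm-factor v (y′ ∷ ys) q
... | ws , pws , concat≡b = a Vec.∷ ws , p ∷ pws , cong (a ++_) concat≡b

module _ {X : Set} {n : ℕ} (w : Vec (List X) n) where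

  expand : List (Fin n) → List X
  expand s = concat (map (Vec.lookup w) s)

  expand-++ : ∀ a b → expand (a ++ b) ≡ expand a ++ expand b
  expand-++ a b = begin
    concat (map (Vec.lookup w) (a ++ b))                    ≡⟨ cong concat (map-++ (Vec.lookup w) a b) ⟩
    concat (map (Vec.lookup w) a ++ map (Vec.lookup w) b)   ≡⟨ concat-++ (map (Vec.lookup w) a) _ ⟨
    expand a ++ expand b                                    ∎

  expand-seg : ∀ i j → expand (seg n i j) ≡ wseg w i j
  expand-seg i j = cong concat (begin
    map (Vec.lookup w) (take (j ∸ i) (drop i (allFin n)))   ≡⟨ take-map (j ∸ i) _ ⟨
    take (j ∸ i) (map (Vec.lookup w) (drop i (allFin n)))   ≡⟨ cong (take (j ∸ i)) (drop-map i (allFin n)) ⟨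
    take (j ∸ i) (drop i (map (Vec.lookup w) (allFin n)))   ≡⟨ cong (slice i j) (map-lookup-allFin w) ⟩
    slice i j (toList w)                                    ∎)

module _ {V X : Set} (v : Valuation V X) {n : ℕ} (w : Vec (List X) n) where

  restrict-segment⇔ : ∀ x {s} → IsSegment n s → restrict v w x s ⇔ v x (expand w s)
  restrict-segment⇔ x (i , j , i≤j , j≤n , refl) = mk⇔
    (λ (i′ , j′ , _ , _ , s≡ , p) → subst (v x) (trans (sym (expand-seg w i′ j′)) (cong (expand w) (sym s≡))) p)
    (λ p → i , j , i≤j , j≤n , refl , subst (v x) (expand-seg w i j) p)

  restrict-segmentValued : SegmentValued n (restrict v w)
  restrict-segmentValued x s (i , j , i≤j , j≤n , s≡ , _) = i , j , i≤j , j≤n , s≡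

  ⟦⟧-restrict-expand : ∀ t s → IsSegment n s → ⟦ t ⟧ (restrict v w) s → ⟦ t ⟧ v (expand w s)
  ⟦⟧-restrict-expand (var x) s seg-s p = Equivalence.to (restrict-segment⇔ x seg-s) p
  ⟦⟧-restrict-expand I       s _ refl = refl
  ⟦⟧-restrict-expand (t · u) s seg-s (a , b , refl , p , q)
    with IsSegment-++⁻ n a b seg-s
  ... | seg-a , seg-b =
    expand w a , expand w b , expand-++ w a b , ⟦⟧-restrict-expand t a seg-a p , ⟦⟧-restrict-expand u b seg-b q
  ⟦⟧-restrict-expand (t ∪ u) s seg-s (inj₁ p) = inj₁ (⟦⟧-restrict-expand t s seg-s p)
  ⟦⟧-restrict-expand (t ∪ u) s seg-s (inj₂ q) = inj₂ (⟦⟧-restrict-expand u s seg-s q)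
  ⟦⟧-restrict-expand (t *)   s seg-s p = star s seg-s p
    where
    star : ∀ s → IsSegment n s → Star (⟦ t ⟧ (restrict v w)) s → Star (⟦ t ⟧ v) (expand w s)
    star _ _ nil = nil
    star _ seg-s (cons {a} {b} p q) with IsSegment-++⁻ n a b seg-s
    ... | seg-a , seg-b =
      subst (Star (⟦ t ⟧ v)) (sym (expand-++ w a b)) (cons (⟦⟧-restrict-expand t a seg-a p) (star b seg-b q))
  ⟦⟧-restrict-expand (x ⁻)   s seg-s ¬p q = ¬p (Equivalence.from (restrict-segment⇔ x seg-s) q)

  letterTerm-restrict : ∀ y k {a rest} → drop k (toList w) ≡ a ∷ rest → suc k ≤ n →
    ⟦ letterTerm y ⟧ v a → ⟦ letterTerm y ⟧ (restrict v w) (seg n k (suc k))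
  letterTerm-restrict y k {a} eq k<n = transfer y
    where
    seg-k : IsSegment n (seg n k (suc k))
    seg-k = k , suc k , n≤1+n k , k<n , refl
    expand≡a : expand w (seg n k (suc k)) ≡ a
    expand≡a = begin
      expand w (seg n k (suc k))          ≡⟨ expand-seg w k (suc k) ⟩
      concat (slice k (suc k) (toList w)) ≡⟨ cong concat (slice-single k (toList w) eq) ⟩
      a ++ []                             ≡⟨ ++-identityʳ a ⟩
      a                                   ∎
    transfer : ∀ y → ⟦ letterTerm y ⟧ v a → ⟦ letterTerm y ⟧ (restrict v w) (seg n k (suc k))
    transfer (pos x) p = Equivalence.from (restrict-segment⇔ x seg-k) (subst (v x) (sym expand≡a) p)
    transfer (neg x) ¬p r = ¬p (subst (v x) expand≡a (Equivalence.to (restrict-segment⇔ x seg-k) r))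

  wordTerm-restrict-seg : ∀ ys k {M} → drop k (toList w) ≡ M → Pointwise (λ y → ⟦ letterTerm y ⟧ v) ys M →
    length ys + k ≤ n → ⟦ wordTerm ys ⟧ (restrict v w) (seg n k (length ys + k))
  wordTerm-restrict-seg []            k _  []       _  = cong (λ m → take m (drop k (allFin n))) (n∸n≡0 k)
  wordTerm-restrict-seg (y ∷ [])      k eq (p ∷ []) le = letterTerm-restrict y k eq le p
  wordTerm-restrict-seg (y ∷ y′ ∷ ys) k eq (p ∷ ps) le =
    seg n k (suc k) , seg n (suc k) (m + suc k) ,
    trans (cong (seg n k) (sym (+-suc m k))) (sym (slice-++ (allFin n) (n≤1+n k) (m≤n+m (suc k) m))) ,
    letterTerm-restrict y k eq (≤-trans (s≤s (m≤n+m k m)) le) p ,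
    wordTerm-restrict-seg (y′ ∷ ys) (suc k) (drop≡∷⇒drop-suc k (toList w) eq) ps
      (≤-trans (≤-reflexive (+-suc m k)) le)
    where m = length (y′ ∷ ys)

restrict⇒LANG⊨ : {V : Set} (u : Word V) (t : Term V) →
  (∀ (X : Set) (v : Valuation V X) (w : Vec (List X) (length u)) →
    ⟦ wordTerm u ⟧ (restrict v w) ⊆ ⟦ t ⟧ (restrict v w)) →
  LANG⊨ wordTerm u ≤ t
restrict⇒LANG⊨ u t H X v a p with wordTerm-factor v u p
... | w , letters , concat≡a =
  subst (⟦ t ⟧ v) expand-full≡a
    (⟦⟧-restrict-expand v w t full (0 , n + 0 , z≤n , n+0≤n , refl)
      (H X v w full (wordTerm-restrict-seg v w u 0 refl letters n+0≤n)))
  where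
  n = length u
  full = seg n 0 (n + 0)
  n+0≤n : n + 0 ≤ n
  n+0≤n = ≤-reflexive (+-identityʳ n)
  expand-full≡a : expand w full ≡ a
  expand-full≡a = begin
    expand w full                        ≡⟨ expand-seg w 0 (n + 0) ⟩
    concat (take (n + 0) (toList w))     ≡⟨ cong concat (take-all (n + 0) (toList w) (≤-trans (≤-reflexive (length-toList w)) (m≤m+n n 0))) ⟩
    concat (toList w)                    ≡⟨ concat≡a ⟩
    a                                    ∎

theorem5p5 : {V : Set} (u : Word V) (t : Term V) →
    ((LANG⊨ wordTerm u ≤ t)
      ⇔ (∀ (v : Valuation V (Fin (length u))) → SegmentValued (length u) v →
           ⟦ wordTerm u ⟧ v ⊆ ⟦ t ⟧ v))
    × ((LANG⊨ wordTerm u ≤ t)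
      ⇔ (∀ (X : Set) (v : Valuation V X) (w : Vec (List X) (length u)) →
           ⟦ wordTerm u ⟧ (restrict v w) ⊆ ⟦ t ⟧ (restrict v w)))
theorem5p5 u t =
  mk⇔ (λ valid v _ → valid _ v)
      (λ segmentValid → restrict⇒LANG⊨ u t λ X v w →
         segmentValid (restrict v w) (restrict-segmentValued v w)) ,
  mk⇔ (λ valid X v w → valid _ (restrict v w)) (restrict⇒LANG⊨ u t)
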